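{- For every graph $G$ with $n$ vertices and maximum degree $\Delta$, the maximum degree of the maximal independent set Glauber graph $\mathcal{M}_{MIS}(G)$ is at most $n\cdot 2^{\Delta^2+\Delta}$.
   Context: $\mathcal{M}_{MIS}(G)$ has as vertices the maximal independent sets of $G=(V,E)$; two maximal independent sets are adjacent iff one is obtained from the other by a move, or by the reversal of a move, where a move from $S$ consists of (1) adding one vertex $v$ to $S$, (2) removing every $u\in S$ with $(u,v)\in E$, and (3) adding a subset of the vertices at distance two in $G$ from $v$ (the result being a maximal independent set). -}

module Defs where

open import Data.Nat using (ℕ; _⊔_)
open import Data.Bool using (Bool; true; false; _∧_; not)
open import Data.Fin using (Fin; _≟_)
open import Data.Fin.Subset using (Subset; _∈_; _∉_; _⊆_; _∪_; _─_; ⁅_⁆; ∣_∣)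
open import Data.Vec using (tabulate)
open import Data.List using (List; map; foldr; allFin)
open import Data.Bool.ListAction using (any)
open import Data.Product using (Σ; ∃; _×_)
open import Relation.Nullary using (¬_)
open import Relation.Nullary.Decidable using (⌊_⌋)
open import Relation.Binary.PropositionalEquality using (_≡_)

record Graph (n : ℕ) : Set where
  field
    adj   : Fin n → Fin n → Bool
    sym   : ∀ u v → adj u v ≡ adj v u
    irrefl : ∀ v → adj v v ≡ false

module _ {n : ℕ} (G : Graph n) where
  open Graph G

  nbhd : Fin n → Subset n
  nbhd v = tabulate (adj v)

  degree : Fin n → ℕ
  degree v = ∣ nbhd v ∣

  maxDegree : ℕ
  maxDegree = foldr _⊔_ 0 (map degree (allFin n))

  dist2 : Fin n → Subset n
  dist2 v = tabulate λ u →
    not ⌊ u ≟ v ⌋ ∧ not (adj v u) ∧ any (λ w → adj v w ∧ adj w u) (allFin n)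

  Independent : Subset n → Set
  Independent S = ∀ u v → u ∈ S → v ∈ S → adj u v ≡ false

  MaximalIndependent : Subset n → Set
  MaximalIndependent S =
    Independent S × (∀ v → v ∉ S → ∃ λ u → u ∈ S × adj u v ≡ true)

  Move : Subset n → Subset n → Set
  Move S T = Σ (Fin n) λ v → v ∉ S × Σ (Subset n) λ A → A ⊆ dist2 v ×
    T ≡ ((S ─ nbhd v) ∪ ⁅ v ⁆) ∪ A × MaximalIndependent T

  MISAdj : Subset n → Subset n → Set
  MISAdj S T = ¬ (S ≡ T) × (Move S T Data.Sum.⊎ Move T S)
    where import Data.Sum

-- A move at v changes a maximal independent set only inside N(v) ∪ {v} ∪ dist2(v),
-- and all of this lies in the union of the closed neighbourhoods of the neighbours
-- of v (v has a neighbour, since it lies outside a maximal independent set), a set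
-- of at most Δ(Δ+1) vertices. So every neighbour of S in M_MIS(G) agrees with S
-- outside one of n such sets, and for each of them only 2^(Δ²+Δ) sets agree with S
-- outside it.
module Submission where

open import Defs
open import Data.Nat using (ℕ; _≤_; _*_; _+_; _^_; suc; _⊔_; z≤n; s≤s)
open import Data.Nat.Properties
  using (≤-trans; ≤-refl; ≤-reflexive; +-mono-≤; +-suc; +-identityʳ; +-comm; m≤m⊔n; m≤n⊔m;
         *-suc; *-monoˡ-≤; ^-monoʳ-≤; module ≤-Reasoning)
open import Data.Bool using (Bool; true; _∧_; not)
open import Data.Bool.Properties using (∨-identityʳ; ∧-conicalˡ; ∧-conicalʳ; T-≡)
open import Data.Bool.ListAction using (any)
open import Data.Fin using (Fin; zero; suc; _≟_)
open import Data.Fin.Subset using (Subset; _∈_; _∉_; _⊆_; _∪_; _─_; ⁅_⁆; ∣_∣; ⊥; inside; outside)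
open import Data.Fin.Subset.Properties
  using (x∈⁅x⁆; x∈⁅y⁆⇒x≡y; ∣⁅x⁆∣≡1; ∣⊥∣≡0; ∣p∣≤∣x∷p∣; drop-there; x∈p∪q⁺)
open import Data.Vec using ([]; _∷_; here; there; lookup; tabulate)
open import Data.Vec.Properties using ([]=⇒lookup; lookup⇒[]=; lookup∘tabulate)
open import Data.List using (List; []; _∷_; [_]; _++_; length; map; foldr; concatMap; allFin)
open import Data.List.Properties using (length-++; length-map; length-removeAt′; length-tabulate)
open import Data.List.Membership.Propositional using (lose) renaming (_∈_ to _∈ˡ_)
open import Data.List.Membership.Propositional.Properties
  using (∈-map⁺; ∈-++⁺ˡ; ∈-++⁺ʳ; ∈-concatMap⁺; ∈-allFin)
open import Data.List.Relation.Unary.All using (All)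
import Data.List.Relation.Unary.All as All
open import Data.List.Relation.Unary.Any as Any using (here; there; satisfied)
open import Data.List.Relation.Unary.Any.Properties using (any⁻)
open import Data.List.Relation.Unary.AllPairs using (_∷_)
open import Data.List.Relation.Unary.Unique.Propositional using (Unique)
open import Data.Product using (∃; _×_; _,_; proj₁; proj₂)
open import Data.Sum using (inj₁; inj₂)
open import Data.Empty using (⊥-elim)
open import Relation.Nullary.Decidable using (⌊_⌋)
open import Function using (_∘_; Equivalence)
open import Relation.Binary.PropositionalEquality
  using (_≡_; _≢_; refl; sym; trans; cong; cong₂; subst; module ≡-Reasoning)

module _ {A : Set} where

  ∈-─ : ∀ {x z : A} {ys : List A} (x∈ys : x ∈ˡ ys) → z ∈ˡ ys → z ≢ x → z ∈ˡ (ys Any.─ x∈ys)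
  ∈-─ (here refl) (here refl) z≢x = ⊥-elim (z≢x refl)
  ∈-─ (here refl) (there z∈ys) _ = z∈ys
  ∈-─ (there x∈ys) (here refl) _ = here refl
  ∈-─ (there x∈ys) (there z∈ys) z≢x = there (∈-─ x∈ys z∈ys z≢x)

  Unique-⊆⇒length≤ : ∀ {xs ys : List A} → Unique xs → (∀ {z} → z ∈ˡ xs → z ∈ˡ ys) →
    length xs ≤ length ys
  Unique-⊆⇒length≤ {[]} _ _ = z≤n
  Unique-⊆⇒length≤ {x ∷ xs} {ys} (x∉xs ∷ unique) xs⊆ys = begin
    suc (length xs)                ≤⟨ s≤s (Unique-⊆⇒length≤ unique xs⊆ys─x) ⟩
    suc (length (ys Any.─ x∈ys))   ≡⟨ sym (length-removeAt′ ys (Any.index x∈ys)) ⟩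
    length ys                      ∎
    where
    open ≤-Reasoning
    x∈ys : x ∈ˡ ys
    x∈ys = xs⊆ys (here refl)
    xs⊆ys─x : ∀ {z} → z ∈ˡ xs → z ∈ˡ (ys Any.─ x∈ys)
    xs⊆ys─x z∈xs = ∈-─ x∈ys (xs⊆ys (there z∈xs)) (λ z≡x → All.lookup x∉xs z∈xs (sym z≡x))

  length-concatMap≤ : ∀ {B : Set} (f : A → List B) {k} → (∀ x → length (f x) ≤ k) →
    (xs : List A) → length (concatMap f xs) ≤ length xs * k
  length-concatMap≤ f bound [] = z≤n
  length-concatMap≤ f bound (x ∷ xs) = begin
    length (f x ++ concatMap f xs)          ≡⟨ length-++ (f x) ⟩
    length (f x) + length (concatMap f xs)  ≤⟨ +-mono-≤ (bound x) (length-concatMap≤ f bound xs) ⟩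
    _ + length xs * _                       ∎
    where open ≤-Reasoning

  any⇒∃ : ∀ (p : A → Bool) xs → any p xs ≡ true → ∃ λ x → p x ≡ true
  any⇒∃ p xs e = let x , px = satisfied (any⁻ p xs (Equivalence.from T-≡ e)) in
    x , Equivalence.to T-≡ px

∈⇒≤-foldr-⊔ : ∀ {x} {xs : List ℕ} → x ∈ˡ xs → x ≤ foldr _⊔_ 0 xs
∈⇒≤-foldr-⊔ {xs = y ∷ _} (here refl) = m≤m⊔n y _
∈⇒≤-foldr-⊔ {xs = y ∷ _} (there x∈xs) = ≤-trans (∈⇒≤-foldr-⊔ x∈xs) (m≤n⊔m y _)

private variable m k : ℕ

∈-tabulate⁺ : ∀ (f : Fin m → Bool) {x} → f x ≡ true → x ∈ tabulate f
∈-tabulate⁺ f {x} fx = lookup⇒[]= x (tabulate f) (trans (lookup∘tabulate f x) fx)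

∈-tabulate⁻ : ∀ (f : Fin m → Bool) {x} → x ∈ tabulate f → f x ≡ true
∈-tabulate⁻ f {x} x∈ = trans (sym (lookup∘tabulate f x)) ([]=⇒lookup x∈)

∣p∪q∣≤∣p∣+∣q∣ : ∀ (p q : Subset m) → ∣ p ∪ q ∣ ≤ ∣ p ∣ + ∣ q ∣
∣p∪q∣≤∣p∣+∣q∣ [] [] = z≤n
∣p∪q∣≤∣p∣+∣q∣ (inside ∷ p) (t ∷ q) =
  s≤s (≤-trans (∣p∪q∣≤∣p∣+∣q∣ p q) (+-mono-≤ (≤-refl {∣ p ∣}) (∣p∣≤∣x∷p∣ t q)))
∣p∪q∣≤∣p∣+∣q∣ (outside ∷ p) (inside ∷ q) =
  ≤-trans (s≤s (∣p∪q∣≤∣p∣+∣q∣ p q)) (≤-reflexive (sym (+-suc ∣ p ∣ ∣ q ∣)))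
∣p∪q∣≤∣p∣+∣q∣ (outside ∷ p) (outside ∷ q) = ∣p∪q∣≤∣p∣+∣q∣ p q

lookup-∪-∉ : ∀ (p q : Subset m) {x} → x ∉ q → lookup (p ∪ q) x ≡ lookup p x
lookup-∪-∉ (s ∷ p) (outside ∷ q) {zero} _ = ∨-identityʳ s
lookup-∪-∉ (s ∷ p) (inside ∷ q) {zero} x∉q = ⊥-elim (x∉q here)
lookup-∪-∉ (s ∷ p) (t ∷ q) {suc x} x∉q = lookup-∪-∉ p q (x∉q ∘ there)

lookup-─-∉ : ∀ (p q : Subset m) {x} → x ∉ q → lookup (p ─ q) x ≡ lookup p x
lookup-─-∉ (s ∷ p) (outside ∷ q) {zero} _ = refl
lookup-─-∉ (s ∷ p) (inside ∷ q) {zero} x∉q = ⊥-elim (x∉q here)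
lookup-─-∉ (s ∷ p) (t ∷ q) {suc x} x∉q = lookup-─-∉ p q (x∉q ∘ there)

AgreeOutside : Subset m → Subset m → Subset m → Set
AgreeOutside C S T = ∀ x → x ∉ C → lookup T x ≡ lookup S x

update-agreesOutside : ∀ {C} (S N V A : Subset m) → N ⊆ C → V ⊆ C → A ⊆ C →
  AgreeOutside C S (((S ─ N) ∪ V) ∪ A)
update-agreesOutside S N V A N⊆C V⊆C A⊆C x x∉C = begin
  lookup (((S ─ N) ∪ V) ∪ A) x  ≡⟨ lookup-∪-∉ ((S ─ N) ∪ V) A (x∉C ∘ A⊆C) ⟩
  lookup ((S ─ N) ∪ V) x        ≡⟨ lookup-∪-∉ (S ─ N) V (x∉C ∘ V⊆C) ⟩
  lookup (S ─ N) x              ≡⟨ lookup-─-∉ S N (x∉C ∘ N⊆C) ⟩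
  lookup S x                    ∎
  where open ≡-Reasoning

AgreeOutside-tail : ∀ {c s t} {C S T : Subset m} →
  AgreeOutside (c ∷ C) (s ∷ S) (t ∷ T) → AgreeOutside C S T
AgreeOutside-tail agree x x∉C = agree (suc x) (x∉C ∘ drop-there)

alterations : Subset m → Subset m → List (Subset m)
alterations [] [] = [ [] ]
alterations (outside ∷ C) (s ∷ S) = map (s ∷_) (alterations C S)
alterations (inside ∷ C) (s ∷ S) =
  map (inside ∷_) (alterations C S) ++ map (outside ∷_) (alterations C S)

length-alterations : (C S : Subset m) → length (alterations C S) ≡ 2 ^ ∣ C ∣
length-alterations [] [] = refl
length-alterations (outside ∷ C) (s ∷ S) =
  trans (length-map (s ∷_) (alterations C S)) (length-alterations C S)
length-alterations (inside ∷ C) (s ∷ S) = begin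
  length (map (inside ∷_) as ++ map (outside ∷_) as)
    ≡⟨ length-++ (map (inside ∷_) as) ⟩
  length (map (inside ∷_) as) + length (map (outside ∷_) as)
    ≡⟨ cong₂ _+_ (length-map (inside ∷_) as) (length-map (outside ∷_) as) ⟩
  length as + length as
    ≡⟨ cong (λ l → l + l) (length-alterations C S) ⟩
  2 ^ ∣ C ∣ + 2 ^ ∣ C ∣
    ≡⟨ cong (2 ^ ∣ C ∣ +_) (sym (+-identityʳ _)) ⟩
  2 ^ suc ∣ C ∣
    ∎
  where
  open ≡-Reasoning
  as = alterations C S

∈-alterations : (C S T : Subset m) → AgreeOutside C S T → T ∈ˡ alterations C S
∈-alterations [] [] [] _ = here refl
∈-alterations (outside ∷ C) (s ∷ S) (t ∷ T) agree with agree zero (λ ())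
... | refl = ∈-map⁺ (s ∷_) (∈-alterations C S T (AgreeOutside-tail agree))
∈-alterations (inside ∷ C) (s ∷ S) (inside ∷ T) agree =
  ∈-++⁺ˡ (∈-map⁺ (inside ∷_) (∈-alterations C S T (AgreeOutside-tail agree)))
∈-alterations (inside ∷ C) (s ∷ S) (outside ∷ T) agree =
  ∈-++⁺ʳ _ (∈-map⁺ (outside ∷_) (∈-alterations C S T (AgreeOutside-tail agree)))

⋃[_]_ : Subset m → (Fin m → Subset k) → Subset k
⋃[ [] ] f = ⊥
⋃[ inside ∷ p ] f = f zero ∪ ⋃[ p ] (f ∘ suc)
⋃[ outside ∷ p ] f = ⋃[ p ] (f ∘ suc)

∣⋃∣≤ : ∀ b (p : Subset m) (f : Fin m → Subset k) → (∀ i → ∣ f i ∣ ≤ b) →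
  ∣ ⋃[ p ] f ∣ ≤ ∣ p ∣ * b
∣⋃∣≤ {k = k} b [] f _ = ≤-reflexive (∣⊥∣≡0 k)
∣⋃∣≤ b (inside ∷ p) f bound =
  ≤-trans (∣p∪q∣≤∣p∣+∣q∣ (f zero) _) (+-mono-≤ (bound zero) (∣⋃∣≤ b p (f ∘ suc) (bound ∘ suc)))
∣⋃∣≤ b (outside ∷ p) f bound = ∣⋃∣≤ b p (f ∘ suc) (bound ∘ suc)

∈-⋃⁺ : ∀ (p : Subset m) (f : Fin m → Subset k) {i x} → i ∈ p → x ∈ f i → x ∈ ⋃[ p ] f
∈-⋃⁺ (inside ∷ p) f here x∈fi = x∈p∪q⁺ (inj₁ x∈fi)
∈-⋃⁺ (inside ∷ p) f (there i∈p) x∈fi = x∈p∪q⁺ (inj₂ (∈-⋃⁺ p (f ∘ suc) i∈p x∈fi))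
∈-⋃⁺ (outside ∷ p) f (there i∈p) x∈fi = ∈-⋃⁺ p (f ∘ suc) i∈p x∈fi

module _ {n : ℕ} (G : Graph n) where
  open Graph G using (adj)

  Δ : ℕ
  Δ = maxDegree G

  degree≤maxDegree : ∀ v → degree G v ≤ Δ
  degree≤maxDegree v = ∈⇒≤-foldr-⊔ (∈-map⁺ (degree G) (∈-allFin v))

  ∈-nbhd⁺ : ∀ {v u} → adj v u ≡ true → u ∈ nbhd G v
  ∈-nbhd⁺ {v} = ∈-tabulate⁺ (adj v)

  dist2⇒commonNeighbour : ∀ {v u} → u ∈ dist2 G v → ∃ λ w → adj v w ≡ true × adj w u ≡ true
  dist2⇒commonNeighbour {v} {u} u∈ =
    w , ∧-conicalˡ (adj v w) (adj w u) vwu , ∧-conicalʳ (adj v w) (adj w u) vwu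
    where
    walk : Fin n → Bool
    walk w = adj v w ∧ adj w u
    w∈walk : ∃ λ w → walk w ≡ true
    w∈walk = any⇒∃ walk (allFin n)
      (∧-conicalʳ (not (adj v u)) _ (∧-conicalʳ (not ⌊ u ≟ v ⌋) _ (∈-tabulate⁻ _ u∈)))
    w = proj₁ w∈walk
    vwu = proj₂ w∈walk

  closedNbhd : Fin n → Subset n
  closedNbhd w = ⁅ w ⁆ ∪ nbhd G w

  ∣closedNbhd∣≤ : ∀ w → ∣ closedNbhd w ∣ ≤ suc Δ
  ∣closedNbhd∣≤ w = begin
    ∣ ⁅ w ⁆ ∪ nbhd G w ∣          ≤⟨ ∣p∪q∣≤∣p∣+∣q∣ ⁅ w ⁆ (nbhd G w) ⟩
    ∣ ⁅ w ⁆ ∣ + degree G w        ≡⟨ cong (_+ degree G w) (∣⁅x⁆∣≡1 w) ⟩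
    suc (degree G w)              ≤⟨ s≤s (degree≤maxDegree w) ⟩
    suc Δ                         ∎
    where open ≤-Reasoning

  -- Contains v itself only when v is not isolated.
  ball₂ : Fin n → Subset n
  ball₂ v = ⋃[ nbhd G v ] closedNbhd

  ∣ball₂∣≤ : ∀ v → ∣ ball₂ v ∣ ≤ Δ * Δ + Δ
  ∣ball₂∣≤ v = begin
    ∣ ball₂ v ∣          ≤⟨ ∣⋃∣≤ (suc Δ) (nbhd G v) closedNbhd ∣closedNbhd∣≤ ⟩
    degree G v * suc Δ   ≤⟨ *-monoˡ-≤ (suc Δ) (degree≤maxDegree v) ⟩
    Δ * suc Δ            ≡⟨ *-suc Δ Δ ⟩
    Δ + Δ * Δ            ≡⟨ +-comm Δ (Δ * Δ) ⟩
    Δ * Δ + Δ            ∎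
    where open ≤-Reasoning

  ∈-ball₂⁺ : ∀ {v w u} → adj v w ≡ true → adj w u ≡ true → u ∈ ball₂ v
  ∈-ball₂⁺ {v} vw wu = ∈-⋃⁺ (nbhd G v) closedNbhd (∈-nbhd⁺ vw) (x∈p∪q⁺ (inj₂ (∈-nbhd⁺ wu)))

  nbhd⊆ball₂ : ∀ v → nbhd G v ⊆ ball₂ v
  nbhd⊆ball₂ v {u} u∈N = ∈-⋃⁺ (nbhd G v) closedNbhd u∈N (x∈p∪q⁺ (inj₁ (x∈⁅x⁆ u)))

  ⁅v⁆⊆ball₂ : ∀ {v w} → adj v w ≡ true → ⁅ v ⁆ ⊆ ball₂ v
  ⁅v⁆⊆ball₂ {v} {w} vw u∈⁅v⁆ rewrite x∈⁅y⁆⇒x≡y v u∈⁅v⁆ =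
    ∈-ball₂⁺ vw (trans (Graph.sym G w v) vw)

  dist2⊆ball₂ : ∀ v → dist2 G v ⊆ ball₂ v
  dist2⊆ball₂ v u∈ = let _ , vw , wu = dist2⇒commonNeighbour u∈ in ∈-ball₂⁺ vw wu

  move-agreesOutside-ball₂ : ∀ {S T} → MaximalIndependent G S → Move G S T →
    ∃ λ v → AgreeOutside (ball₂ v) S T
  move-agreesOutside-ball₂ {S} (_ , maximal) (v , v∉S , A , A⊆dist2 , refl , _) =
    let w , _ , wv = maximal v v∉S in
    v , update-agreesOutside S (nbhd G v) ⁅ v ⁆ A (nbhd⊆ball₂ v)
          (⁅v⁆⊆ball₂ (trans (Graph.sym G v w) wv)) (dist2⊆ball₂ v ∘ A⊆dist2)

  MISAdj-agreesOutside-ball₂ : ∀ {S T} → MaximalIndependent G S → MaximalIndependent G T →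
    MISAdj G S T → ∃ λ v → AgreeOutside (ball₂ v) S T
  MISAdj-agreesOutside-ball₂ misS _ (_ , inj₁ move) = move-agreesOutside-ball₂ misS move
  MISAdj-agreesOutside-ball₂ _ misT (_ , inj₂ move) =
    let v , agree = move-agreesOutside-ball₂ misT move in
    v , λ x x∉ball₂ → sym (agree x x∉ball₂)

  candidates : Subset n → List (Subset n)
  candidates S = concatMap (λ v → alterations (ball₂ v) S) (allFin n)

  length-candidates : ∀ S → length (candidates S) ≤ n * 2 ^ (Δ * Δ + Δ)
  length-candidates S = subst (λ l → length (candidates S) ≤ l * 2 ^ (Δ * Δ + Δ))
    (length-tabulate {n = n} (λ v → v))
    (length-concatMap≤ (λ v → alterations (ball₂ v) S) alterations≤ (allFin n))
    where
    alterations≤ : ∀ v → length (alterations (ball₂ v) S) ≤ 2 ^ (Δ * Δ + Δ)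
    alterations≤ v = begin
      length (alterations (ball₂ v) S)  ≡⟨ length-alterations (ball₂ v) S ⟩
      2 ^ ∣ ball₂ v ∣                    ≤⟨ ^-monoʳ-≤ 2 (∣ball₂∣≤ v) ⟩
      2 ^ (Δ * Δ + Δ)                   ∎
      where open ≤-Reasoning

  ∈-candidates : ∀ {S T} v → AgreeOutside (ball₂ v) S T → T ∈ˡ candidates S
  ∈-candidates {S} {T} v agree = ∈-concatMap⁺ (λ v → alterations (ball₂ v) S)
    (lose (∈-allFin v) (∈-alterations (ball₂ v) S T agree))

lemma27 : (n : ℕ) (G : Graph n) (S : Subset n) → MaximalIndependent G S →
    (Ts : List (Subset n)) → Unique Ts → All (λ T → MaximalIndependent G T × MISAdj G S T) Ts →
      length Ts ≤ n * 2 ^ (maxDegree G * maxDegree G + maxDegree G)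
lemma27 n G S misS Ts unique neighbours =
  ≤-trans (Unique-⊆⇒length≤ unique Ts⊆candidates) (length-candidates G S)
  where
  Ts⊆candidates : ∀ {T} → T ∈ˡ Ts → T ∈ˡ candidates G S
  Ts⊆candidates T∈Ts =
    let misT , S~T = All.lookup neighbours T∈Ts
        v , agree = MISAdj-agreesOutside-ball₂ G misS misT S~T
    in ∈-candidates G v agree
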